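{- Let $G$ be a simple $K_{1,3}$-free graph. For any vertex $x\in V(G)$ and any integer $k\geq 3$, if $\deg_G(x)\ge 2k-1$, then $G$ contains a chorded cycle of length $k+1$.
   Context: A graph is $K_{1,3}$-free (claw-free) if it contains no induced subgraph isomorphic to the star $K_{1,3}$. A chorded cycle in $G$ is a cycle $C$ of $G$ such that $G$ contains an edge joining two vertices of $C$ that are not consecutive on $C$ (a chord). An $m$-cycle is a cycle on $m$ vertices. -}

module Defs where

open import Data.Nat using (ℕ; zero; suc; _+_; _≤_)
open import Data.Bool using (Bool; true; false; T)
open import Data.Fin using (Fin; toℕ)
open import Data.Fin.Properties using ()
open import Data.List using (List; length; filter; allFin)
open import Data.Nat.DivMod using (_%_)
open import Data.Product using (Σ; _×_; ∃; ∃-syntax)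
open import Relation.Binary.PropositionalEquality using (_≡_)
open import Relation.Nullary using (¬_)
open import Function.Definitions using (Injective)
open import Data.Bool.Properties using (T?)

record Graph (n : ℕ) : Set where
  field
    adj   : Fin n → Fin n → Bool
    sym   : ∀ x y → adj x y ≡ adj y x
    irrefl : ∀ x → adj x x ≡ false
open Graph public

Adj : ∀ {n} → Graph n → Fin n → Fin n → Set
Adj G x y = T (adj G x y)

deg : ∀ {n} → Graph n → Fin n → ℕ
deg G x = length (filter (λ y → T? (adj G x y)) (allFin _))

HasClaw : ∀ {n} → Graph n → Set
HasClaw {n} G = Σ (Fin n) λ c → Σ (Fin n) λ a → Σ (Fin n) λ b → Σ (Fin n) λ d →
  Adj G c a × Adj G c b × Adj G c d ×
  ¬ a ≡ b × ¬ a ≡ d × ¬ b ≡ d ×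
  ¬ Adj G a b × ¬ Adj G a d × ¬ Adj G b d

ClawFree : ∀ {n} → Graph n → Set
ClawFree G = ¬ HasClaw G

next : ∀ {m} → Fin m → ℕ
next {suc m} i = suc (toℕ i) % suc m

Consecutive : ∀ {m} → Fin m → Fin m → Set
Consecutive {m} i j = (toℕ j ≡ next {m} i) Data.Sum.⊎ (toℕ i ≡ next {m} j)
  where import Data.Sum

record Cycle {n} (G : Graph n) (m : ℕ) : Set where
  field
    three≤m : 3 ≤ m
    vert    : Fin m → Fin n
    inj     : Injective _≡_ _≡_ vert
    edges   : ∀ (i j : Fin m) → toℕ j ≡ next {m} i → Adj G (vert i) (vert j)
open Cycle public

HasChord : ∀ {n} {G : Graph n} {m} → Cycle G m → Set
HasChord {G = G} {m} C = Σ (Fin m) λ i → Σ (Fin m) λ j →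
  ¬ i ≡ j × ¬ Consecutive {m} i j × Adj G (vert C i) (vert C j)

HasChordedCycle : ∀ {n} → Graph n → ℕ → Set
HasChordedCycle G m = Σ (Cycle G m) HasChord

-- In a claw-free graph the neighbourhood N(x) has no independent set of size 3,
-- so it can be covered by two vertex-disjoint paths: insert the neighbours one at
-- a time, each time either extending an end of one path, or, if the new vertex is
-- adjacent to neither end, joining the two paths through their (then adjacent)
-- ends and starting a fresh path with it.  One of the two paths gets at least k
-- of the at least 2k − 1 neighbours; x followed by its first k vertices is a
-- (k+1)-cycle, and x is also adjacent to the second vertex, which gives a chord.
module Submission where

open import Defs
open import Level using (Level; _⊔_)
open import Data.Nat using (ℕ; zero; suc; _+_; _*_; _∸_; _≤_; z≤n; s≤s)
open import Data.Nat.Properties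
  using (≤-trans; ≤-reflexive; +-identityʳ; +-cancelˡ-≤; +-monoˡ-≤; ≰⇒>; suc-injective; m≤n⇒m<n∨m≡n)
  renaming (_≤?_ to _≤ℕ?_)
open import Data.Nat.DivMod using (_%_; n%n≡0; m<n⇒m%n≡m)
open import Data.Fin using (Fin; toℕ; inject≤) renaming (zero to fz; suc to fs)
open import Data.Fin.Properties using (toℕ-inject≤; toℕ<n; inject≤-injective)
open import Data.Bool using (T)
open import Data.Bool.Properties using (T?)
open import Data.List using (List; []; _∷_; [_]; _++_; _ʳ++_; length; lookup; filter; allFin)
open import Data.List.Properties using (length-++)
open import Data.List.Relation.Unary.All using (All; []; _∷_) renaming (lookup to All-lookup)
open import Data.List.Relation.Unary.All.Properties using (all-filter) renaming (++⁻ˡ to All-++⁻ˡ)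
open import Data.List.Relation.Unary.AllPairs using ([]; _∷_)
open import Data.List.Relation.Unary.Any using (here; there)
open import Data.List.Relation.Unary.Linked using (Linked; []; [-]; _∷_)
open import Data.List.Relation.Unary.Unique.Propositional using (Unique)
open import Data.List.Relation.Unary.Unique.Propositional.Properties using (filter⁺; allFin⁺)
open import Data.List.Membership.Propositional using (_∈_)
open import Data.List.Membership.Propositional.Properties using (∈-lookup; ∈-++⁺ʳ)
open import Data.List.Relation.Binary.Permutation.Propositional
  using (_↭_; refl; prep; trans; ↭-sym; ↭⇒↭ₛ)
open import Data.List.Relation.Binary.Permutation.Propositional.Properties
  using (All-resp-↭; ∈-resp-↭; ↭-length; ++-comm; shift; ++↭ʳ++)
import Data.List.Relation.Binary.Permutation.Setoid.Properties as ↭ₛ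
open import Data.Product using (Σ-syntax; _×_; _,_)
open import Data.Sum using (_⊎_; inj₁; inj₂)
open import Data.Empty using (⊥; ⊥-elim)
open import Relation.Nullary using (¬_; yes; no)
open import Relation.Binary.Core using (Rel)
open import Relation.Binary.Definitions using (Symmetric; Decidable)
open import Relation.Binary.PropositionalEquality
  using (_≡_; _≢_; cong; subst; setoid) renaming (refl to ≡-refl; sym to ≡-sym; trans to ≡-trans)

private
  variable
    a ℓ : Level
    A : Set a

Unique-resp-↭ : {xs ys : List A} → xs ↭ ys → Unique xs → Unique ys
Unique-resp-↭ {A = A} p = ↭ₛ.Unique-resp-↭ (setoid A) (↭⇒↭ₛ p)

Unique-++⁻ˡ : (xs : List A) {ys : List A} → Unique (xs ++ ys) → Unique xs
Unique-++⁻ˡ []       _         = []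
Unique-++⁻ˡ (x ∷ xs) (h ∷ u) = All-++⁻ˡ xs h ∷ Unique-++⁻ˡ xs u

Unique⇒lookup-injective : {xs : List A} → Unique xs →
                          (i j : Fin (length xs)) → lookup xs i ≡ lookup xs j → i ≡ j
Unique⇒lookup-injective {xs = _ ∷ _} _       fz     fz     _ = ≡-refl
Unique⇒lookup-injective {xs = _ ∷ _} (h ∷ _) fz     (fs j) e = ⊥-elim (All-lookup h (∈-lookup j) e)
Unique⇒lookup-injective {xs = _ ∷ _} (h ∷ _) (fs i) fz     e = ⊥-elim (All-lookup h (∈-lookup i) (≡-sym e))
Unique⇒lookup-injective {xs = _ ∷ _} (_ ∷ u) (fs i) (fs j) e = cong fs (Unique⇒lookup-injective u i j e)

Linked⇒lookup-suc : {R : Rel A ℓ} {xs : List A} → Linked R xs →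
                    (i j : Fin (length xs)) → toℕ j ≡ suc (toℕ i) → R (lookup xs i) (lookup xs j)
Linked⇒lookup-suc (r ∷ _) fz     (fs fz) _ = r
Linked⇒lookup-suc (_ ∷ l) (fs i) (fs j)  e = Linked⇒lookup-suc l i j (suc-injective e)

2*k∸1≤m+n⇒k≤m⊎k≤n : ∀ k m n → 2 * k ∸ 1 ≤ m + n → k ≤ m ⊎ k ≤ n
2*k∸1≤m+n⇒k≤m⊎k≤n zero    _ _ _ = inj₁ z≤n
2*k∸1≤m+n⇒k≤m⊎k≤n (suc k) m n h with suc k ≤ℕ? m
... | yes k<m = inj₁ k<m
... | no  k≮m = inj₂ (subst (_≤ n) (cong suc (+-identityʳ k))
                       (+-cancelˡ-≤ k _ _ (≤-trans h (+-monoˡ-≤ n m≤k))))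
  where
  m≤k : m ≤ k
  m≤k with ≰⇒> k≮m
  ... | s≤s m≤k = m≤k

next-fs⁻¹ : ∀ {m} (i j : Fin m) → toℕ (fs j) ≡ next (fs i) → toℕ j ≡ suc (toℕ i)
next-fs⁻¹ {m} i j e with m≤n⇒m<n∨m≡n (toℕ<n i)
... | inj₁ i+1<m = suc-injective (≡-trans e (m<n⇒m%n≡m (s≤s i+1<m)))
... | inj₂ i+1≡m with ≡-trans e (≡-trans (cong (λ t → suc t % suc m) i+1≡m) (n%n≡0 (suc m)))
... | ()

module PathCover {A : Set a} {R : Rel A ℓ} (R? : Decidable R) (R-sym : Symmetric R) where

  IndependentTripleFree : List A → Set (a ⊔ ℓ)
  IndependentTripleFree S = ∀ {u v w} → u ∈ S → v ∈ S → w ∈ S →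
    u ≢ v → u ≢ w → v ≢ w → ¬ R u v → ¬ R u w → ¬ R v w → ⊥

  -- Both paths grow at their heads, which are the ends the insertion looks at.
  record PathPair (S : List A) : Set (a ⊔ ℓ) where
    constructor pathPair
    field
      P Q      : List A
      P-linked : Linked R P
      Q-linked : Linked R Q
      P++Q↭S   : P ++ Q ↭ S

  ʳ++⁺ : ∀ {x xs ys} → Linked R (x ∷ xs) → Linked R (x ∷ ys) → Linked R (xs ʳ++ x ∷ ys)
  ʳ++⁺ [-]        l = l
  ʳ++⁺ (r ∷ lxs) l = ʳ++⁺ lxs (R-sym r ∷ l)

  insert : ∀ {x S} → Unique (x ∷ S) → IndependentTripleFree (x ∷ S) → PathPair S → PathPair (x ∷ S)
  insert {x = x} _ _ (pathPair [] Q _ lQ π) = pathPair [ x ] Q [-] lQ (prep x π)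
  insert {x = x} _ _ (pathPair P@(p ∷ _) [] lP _ π) with R? x p
  ... | yes xp = pathPair (x ∷ P) [] (xp ∷ lP) [] (prep x π)
  ... | no  _  = pathPair P [ x ] lP [-] (trans (shift x P []) (prep x π))
  insert {x = x} {S} (x∉S ∷ uS) free (pathPair P@(p ∷ ps) Q@(q ∷ _) lP lQ π)
    with R? x p | R? x q | R? p q
  ... | yes xp | _      | _      = pathPair (x ∷ P) Q (xp ∷ lP) lQ (prep x π)
  ... | no  _  | yes xq | _      = pathPair P (x ∷ Q) lP (xq ∷ lQ) (trans (shift x P Q) (prep x π))
  ... | no  _  | no  _  | yes pq =
    pathPair [ x ] (ps ʳ++ p ∷ Q) [-] (ʳ++⁺ lP (pq ∷ lQ)) (prep x (trans (↭-sym (++↭ʳ++ P Q)) π))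
  ... | no ¬xp | no ¬xq | no ¬pq =
    ⊥-elim (free (here ≡-refl) (there p∈S) (there q∈S)
                 (All-lookup x∉S p∈S) (All-lookup x∉S q∈S) p≢q ¬xp ¬xq ¬pq)
    where
    p∈S : p ∈ S
    p∈S = ∈-resp-↭ π (here ≡-refl)
    q∈S : q ∈ S
    q∈S = ∈-resp-↭ π (∈-++⁺ʳ P (here ≡-refl))
    p≢q : p ≢ q
    p≢q with Unique-resp-↭ (↭-sym π) uS
    ... | p∉ps++Q ∷ _ = All-lookup p∉ps++Q (∈-++⁺ʳ ps (here ≡-refl))

  twoPathCover : ∀ S → Unique S → IndependentTripleFree S → PathPair S
  twoPathCover []      _          _    = pathPair [] [] [] [] refl
  twoPathCover (x ∷ S) u@(_ ∷ uS) free =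
    insert u free (twoPathCover S uS (λ u∈ v∈ w∈ → free (there u∈) (there v∈) (there w∈)))

  longerPath : ∀ {S} k → PathPair S → 2 * k ∸ 1 ≤ length S →
               Σ[ L ∈ List A ] Σ[ M ∈ List A ] Linked R L × L ++ M ↭ S × k ≤ length L
  longerPath k (pathPair P Q lP lQ π) h
    with 2*k∸1≤m+n⇒k≤m⊎k≤n k (length P) (length Q)
           (≤-trans h (≤-reflexive (≡-trans (≡-sym (↭-length π)) (length-++ P))))
  ... | inj₁ k≤P = P , Q , lP , π , k≤P
  ... | inj₂ k≤Q = Q , P , lQ , trans (++-comm Q P) π , k≤Q

module _ {n : ℕ} (G : Graph n) where

  Adj-sym : Symmetric (Adj G)
  Adj-sym {u} {v} = subst T (Graph.sym G u v)

  Adj? : Decidable (Adj G)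
  Adj? u v = T? (adj G u v)

  open PathCover Adj? Adj-sym

  neighbours : Fin n → List (Fin n)
  neighbours x = filter (Adj? x) (allFin n)

  clawFree⇒independentTripleFree : ClawFree G → ∀ {x S} → All (Adj G x) S → IndependentTripleFree S
  clawFree⇒independentTripleFree cf {x} xS u∈ v∈ w∈ u≢v u≢w v≢w ¬uv ¬uw ¬vw =
    cf (x , _ , _ , _ , All-lookup xS u∈ , All-lookup xS v∈ , All-lookup xS w∈ ,
        u≢v , u≢w , v≢w , ¬uv , ¬uw , ¬vw)

  neighbours-unique : ∀ x → Unique (neighbours x)
  neighbours-unique x = filter⁺ (Adj? x) (allFin⁺ n)

  neighbours-adj : ∀ x → All (Adj G x) (neighbours x)
  neighbours-adj x = all-filter (Adj? x) (allFin n)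

  neighbourPath : ClawFree G → ∀ x k → 2 * k ∸ 1 ≤ deg G x →
    Σ[ L ∈ List (Fin n) ] Linked (Adj G) L × Unique L × All (Adj G x) L × k ≤ length L
  neighbourPath cf x k h
    with longerPath k (twoPathCover (neighbours x) (neighbours-unique x)
                         (clawFree⇒independentTripleFree cf (neighbours-adj x))) h
  ... | L , _ , lL , π , k≤L =
    L , lL , Unique-++⁻ˡ L (Unique-resp-↭ (↭-sym π) (neighbours-unique x)) ,
    All-++⁻ˡ L (All-resp-↭ (↭-sym π) (neighbours-adj x)) , k≤L

  module Fan {x : Fin n} {L : List (Fin n)}
             (L-linked : Linked (Adj G) L) (L-unique : Unique L) (x-adj-L : All (Adj G x) L) where

    x-adj : ∀ i → Adj G x (lookup L i)
    x-adj i = All-lookup x-adj-L (∈-lookup i)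

    x∉L : ∀ i → x ≢ lookup L i
    x∉L i e = subst T (Graph.irrefl G x) (subst (Adj G x) (≡-sym e) (x-adj i))

    fanCycle : ∀ m → suc (suc m) ≤ length L → Cycle G (3 + m)
    fanCycle m le = record
      { three≤m = s≤s (s≤s (s≤s z≤n)) ; vert = vertex ; inj = vertex-injective ; edges = vertex-adj }
      where
      vertex : Fin (3 + m) → Fin n
      vertex fz     = x
      vertex (fs i) = lookup L (inject≤ i le)

      vertex-injective : ∀ {i j} → vertex i ≡ vertex j → i ≡ j
      vertex-injective {fz}   {fz}   _ = ≡-refl
      vertex-injective {fz}   {fs j} e = ⊥-elim (x∉L _ e)
      vertex-injective {fs i} {fz}   e = ⊥-elim (x∉L _ (≡-sym e))
      vertex-injective {fs i} {fs j} e = cong fs (inject≤-injective le le i j (Unique⇒lookup-injective L-unique _ _ e))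

      vertex-adj : ∀ i j → toℕ j ≡ next i → Adj G (vertex i) (vertex j)
      vertex-adj fz     (fs j) _ = x-adj _
      vertex-adj (fs i) fz     _ = Adj-sym (x-adj _)
      vertex-adj (fs i) (fs j) e = Linked⇒lookup-suc L-linked _ _
        (≡-trans (toℕ-inject≤ j le) (≡-trans (next-fs⁻¹ i j e) (cong suc (≡-sym (toℕ-inject≤ i le)))))

    fanCycle-chord : ∀ m (le : 3 + m ≤ length L) → HasChord (fanCycle (suc m) le)
    fanCycle-chord m _ = fz , fs (fs fz) , (λ ()) , (λ { (inj₁ ()) ; (inj₂ ()) }) , x-adj _

lemma2 : (n : ℕ) (G : Graph n) → ClawFree G →
    (x : Fin n) (k : ℕ) → 3 ≤ k → 2 * k ∸ 1 ≤ deg G x →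
    HasChordedCycle G (suc k)
lemma2 n G cf x k@(suc (suc (suc m))) (s≤s (s≤s (s≤s _))) h with neighbourPath G cf x k h
... | L , lL , uL , xL , k≤L = fanCycle (suc m) k≤L , fanCycle-chord m k≤L
  where open Fan G lL uL xL
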